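{- (Completeness.) Let $r\in\{f,\beta\}$, let $U_1,\dots,U_n,U\in\mathbb U$ and let $M\in\mathcal M$ with $FV(M)=\{x_1,\dots,x_n\}$. If for every $r$-interpretation $\mathcal I$ and all $N_i\in\mathcal I(U_i)$ ($1\le i\le n$) we have $M[(x_i:=N_i)_1^n]\in\mathcal I(U)$, then $M:\langle (x_i:U_i)_n\vdash U\rangle$ is derivable.
   Context: Terms: $\mathcal V$ is a denumerably infinite set of variables; $\mathcal M$ is the set of untyped $\lambda$-terms $M::=x\mid \lambda x.M\mid MM$ taken modulo $\alpha$-conversion; $FV(M)$ is the set of free variables; $M[(x_i:=N_i)_1^n]$ is simultaneous capture-avoiding substitution. $\rhd_\beta$ is the compatible closure of $(\lambda x.M)N\rhd_\beta M[x:=N]$. Weak head reduction: $M\rhd_f N$ iff $M=(\lambda x.P)QQ_1\dots Q_n$ and $N=P[x:=Q]Q_1\dots Q_n$ for some $n\ge 0$. $\rhd_r^*$ is the reflexive-transitive closure of $\rhd_r$. Types: $\mathcal A$ is a denumerably infinite set of atomic types; $\mathbb T::=a\mid \mathbb U\to\mathbb T$ ($a\in\mathcal A$) and $\mathbb U::=\omega\mid \mathbb U\sqcap\mathbb U\mid \mathbb T$; types are quotiented by commutativity, associativity and idempotence of $\sqcap$ and by $\omega\sqcap U=U$. $T$ ranges over $\mathbb T$, $U,V$ over $\mathbb U$. Environments: a type environment is a finite set $(x_i:U_i)_n$ of declarations with pairwise distinct variables; $dom$ is its set of variables; $()$ is the empty environment; $\Gamma,x:U$ requires $x\notin dom(\Gamma)$;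 $env^M_\omega$ assigns $\omega$ to each variable of $FV(M)$ and nothing else; if $\Gamma_1=(x_i:U_i)_n,(y_j:V_j)_m$ and $\Gamma_2=(x_i:U'_i)_n,(z_k:W_k)_l$ with the $y_j$, $z_k$ all distinct, then $\Gamma_1\sqcap\Gamma_2=(x_i:U_i\sqcap U'_i)_n,(y_j:V_j)_m,(z_k:W_k)_l$. Subtyping: $\sqsubseteq$ (on types, on environments, and on typings $\langle\Gamma\vdash U\rangle$) is the least relation closed under: $\Phi\sqsubseteq\Phi$; transitivity; $U_1\sqcap U_2\sqsubseteq U_1$; if $U_1\sqsubseteq V_1$ and $U_2\sqsubseteq V_2$ then $U_1\sqcap U_2\sqsubseteq V_1\sqcap V_2$; if $U_2\sqsubseteq U_1$ and $T_1\sqsubseteq T_2$ then $U_1\to T_1\sqsubseteq U_2\to T_2$; if $U_1\sqsubseteq U_2$ and $x\notin dom(\Gamma)$ then $\Gamma,x:U_1\sqsubseteq\Gamma,x:U_2$; if $U_1\sqsubseteq U_2$ and $\Gamma_2\sqsubseteq\Gamma_1$ then $\langle\Gamma_1\vdash U_1\rangle\sqsubseteq\langle\Gamma_2\vdash U_2\rangle$. Typing rules for $M:\langle\Gamma\vdash U\rangle$: (ax) $x:\langle x:T\vdash T\rangle$ for $T\in\mathbb T$; ($\omega$) $M:\langle env^M_\omega\vdash\omega\rangle$; ($\to_i$) from $M:\langle\Gamma,x:U\vdash T\rangle$ infer $\lambda x.M:\langle\Gamma\vdash U\to T\rangle$; ($\to'_i$) from $M:\langle\Gamma\vdash T\rangle$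 and $x\notin dom(\Gamma)$ infer $\lambda x.M:\langle\Gamma\vdash\omega\to T\rangle$; ($\to_e$) from $M_1:\langle\Gamma_1\vdash U\to T\rangle$ and $M_2:\langle\Gamma_2\vdash U\rangle$ infer $M_1M_2:\langle\Gamma_1\sqcap\Gamma_2\vdash T\rangle$; ($\sqcap_i$) from $M:\langle\Gamma\vdash U_1\rangle$ and $M:\langle\Gamma\vdash U_2\rangle$ infer $M:\langle\Gamma\vdash U_1\sqcap U_2\rangle$; ($\sqsubseteq$) from $M:\langle\Gamma\vdash U\rangle$ and $\langle\Gamma\vdash U\rangle\sqsubseteq\langle\Gamma'\vdash U'\rangle$ infer $M:\langle\Gamma'\vdash U'\rangle$. Semantics: for $\mathcal X,\mathcal Y\subseteq\mathcal M$, $\mathcal X\leadsto\mathcal Y=\{M\in\mathcal M\mid MN\in\mathcal Y\text{ for all }N\in\mathcal X\}$. For $r\in\{f,\beta\}$, $\mathcal X$ is $r$-saturated if $M\rhd_r^*N$ and $N\in\mathcal X$ imply $M\in\mathcal X$. An $r$-interpretation is a function $\mathcal I:\mathcal A\to\mathcal P(\mathcal M)$ with every $\mathcal I(a)$ $r$-saturated, extended to $\mathbb U$ by $\mathcal I(\omega)=\mathcal M$, $\mathcal I(U_1\sqcap U_2)=\mathcal I(U_1)\cap\mathcal I(U_2)$, $\mathcal I(U\to T)=\mathcal I(U)\leadsto\mathcal I(T)$. -}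

module Defs where

open import Data.Nat using (ℕ; zero; suc; _≡ᵇ_)
open import Data.Bool using (Bool; true; false; if_then_else_; _∨_)
open import Data.Maybe using (Maybe; just; nothing)
open import Data.Product using (_×_; _,_)
open import Data.Unit using (⊤)
open import Data.List using (List; []; _∷_)
open import Data.List.Relation.Unary.All using (All)
open import Data.Vec using (Vec; []; _∷_)
open import Relation.Binary.PropositionalEquality using (_≡_)
open import Relation.Binary.Construct.Closure.ReflexiveTransitive using (Star)

-- Terms (locally nameless: free variables are names in 𝒱 = ℕ, bound
-- variables are de Bruijn indices; this realises terms modulo α).

Var : Set
Var = ℕ

data Term : Set where
  bvar : ℕ → Term
  fvar : Var → Term
  app  : Term → Term → Term
  lam  : Term → Term

openAt : ℕ → Term → Term → Term
openAt k u (bvar i)  = if i ≡ᵇ k then u else bvar i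
openAt k u (fvar x)  = fvar x
openAt k u (app s t) = app (openAt k u s) (openAt k u t)
openAt k u (lam t)   = lam (openAt (suc k) u t)

closeAt : ℕ → Var → Term → Term
closeAt k x (bvar i)  = bvar i
closeAt k x (fvar y)  = if y ≡ᵇ x then bvar k else fvar y
closeAt k x (app s t) = app (closeAt k x s) (closeAt k x t)
closeAt k x (lam t)   = lam (closeAt (suc k) x t)

ƛ : Var → Term → Term
ƛ x M = lam (closeAt 0 x M)

-- locally closed terms: these are the elements of 𝓜
data LC : Term → Set where
  lc-var : ∀ x → LC (fvar x)
  lc-app : ∀ {s t} → LC s → LC t → LC (app s t)
  lc-lam : ∀ {t} → (∀ x → LC (openAt 0 (fvar x) t)) → LC (lam t)

occurs : Var → Term → Bool
occurs x (bvar i)  = false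
occurs x (fvar y)  = x ≡ᵇ y
occurs x (app s t) = occurs x s ∨ occurs x t
occurs x (lam t)   = occurs x t

_∈FV_ : Var → Term → Set
x ∈FV M = occurs x M ≡ true

-- simultaneous substitution of names (capture-avoiding for locally
-- closed substituted terms)
subst : (Var → Term) → Term → Term
subst σ (bvar i)  = bvar i
subst σ (fvar x)  = σ x
subst σ (app s t) = app (subst σ s) (subst σ t)
subst σ (lam t)   = lam (subst σ t)

substOf : ∀ {n} → Vec Var n → Vec Term n → Var → Term
substOf []       []       y = fvar y
substOf (x ∷ xs) (N ∷ Ns) y = if y ≡ᵇ x then N else substOf xs Ns y

data _▷β_ : Term → Term → Set where
  β-red : ∀ {t u} → LC (lam t) → LC u → app (lam t) u ▷β openAt 0 u t
  β-appl : ∀ {s s' t} → s ▷β s' → LC t → app s t ▷β app s' t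
  β-appr : ∀ {s t t'} → LC s → t ▷β t' → app s t ▷β app s t'
  β-lam : ∀ {M M'} x → M ▷β M' → ƛ x M ▷β ƛ x M'

apps : Term → List Term → Term
apps M []       = M
apps M (Q ∷ Qs) = apps (app M Q) Qs

data _▷f_ : Term → Term → Set where
  f-red : ∀ {t q} (qs : List Term) → LC (lam t) → LC q → All LC qs →
          apps (app (lam t) q) qs ▷f apps (openAt 0 q t) qs

data RedKind : Set where
  f β : RedKind

_▷[_]_ : Term → RedKind → Term → Set
M ▷[ f ] N = M ▷f N
M ▷[ β ] N = M ▷β N

_▷[_]*_ : Term → RedKind → Term → Set
M ▷[ r ]* N = Star (λ P Q → P ▷[ r ] Q) M N

-- Types (raw syntax; the quotient is given by _≈ᵤ_ below)

Atom : Set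
Atom = ℕ

data 𝕋 : Set
data 𝕌 : Set

data 𝕋 where
  atom : Atom → 𝕋
  _⇒_  : 𝕌 → 𝕋 → 𝕋

data 𝕌 where
  ω   : 𝕌
  _⊓_ : 𝕌 → 𝕌 → 𝕌
  ty  : 𝕋 → 𝕌

infixr 5 _⇒_
infixl 6 _⊓_

data _≈ₜ_ : 𝕋 → 𝕋 → Set
data _≈ᵤ_ : 𝕌 → 𝕌 → Set

data _≈ₜ_ where
  ≈ₜ-refl  : ∀ {T} → T ≈ₜ T
  ≈ₜ-sym   : ∀ {T T'} → T ≈ₜ T' → T' ≈ₜ T
  ≈ₜ-trans : ∀ {T T' T''} → T ≈ₜ T' → T' ≈ₜ T'' → T ≈ₜ T''
  ≈ₜ-⇒     : ∀ {U U' T T'} → U ≈ᵤ U' → T ≈ₜ T' → (U ⇒ T) ≈ₜ (U' ⇒ T')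

data _≈ᵤ_ where
  ≈ᵤ-refl  : ∀ {U} → U ≈ᵤ U
  ≈ᵤ-sym   : ∀ {U U'} → U ≈ᵤ U' → U' ≈ᵤ U
  ≈ᵤ-trans : ∀ {U U' U''} → U ≈ᵤ U' → U' ≈ᵤ U'' → U ≈ᵤ U''
  ≈ᵤ-ty    : ∀ {T T'} → T ≈ₜ T' → ty T ≈ᵤ ty T'
  ≈ᵤ-⊓     : ∀ {U₁ U₂ V₁ V₂} → U₁ ≈ᵤ V₁ → U₂ ≈ᵤ V₂ → (U₁ ⊓ U₂) ≈ᵤ (V₁ ⊓ V₂)
  ⊓-comm   : ∀ {U V} → (U ⊓ V) ≈ᵤ (V ⊓ U)
  ⊓-assoc  : ∀ {U V W} → ((U ⊓ V) ⊓ W) ≈ᵤ (U ⊓ (V ⊓ W))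
  ⊓-idem   : ∀ {U} → (U ⊓ U) ≈ᵤ U
  ω-unit   : ∀ {U} → (ω ⊓ U) ≈ᵤ U

-- Environments: finite partial maps Var ⇀ 𝕌 (only finite ones arise)

Env : Set
Env = Var → Maybe 𝕌

-- extensional equality of environments (environments are sets)
_≗ₑ_ : Env → Env → Set
Γ ≗ₑ Δ = ∀ x → Γ x ≡ Δ x

∅ₑ : Env
∅ₑ y = nothing

-- Γ , x : U   (used only when x ∉ dom Γ, i.e. Γ x ≡ nothing)
_⸴_⦂_ : Env → Var → 𝕌 → Env
(Γ ⸴ x ⦂ U) y = if y ≡ᵇ x then just U else Γ y

[_∶_] : Var → 𝕌 → Env
[ x ∶ U ] = ∅ₑ ⸴ x ⦂ U

envOf : ∀ {n} → Vec Var n → Vec 𝕌 n → Env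
envOf []       []       = ∅ₑ
envOf (x ∷ xs) (U ∷ Us) = envOf xs Us ⸴ x ⦂ U

_⊓ₑ_ : Env → Env → Env
(Γ₁ ⊓ₑ Γ₂) y with Γ₁ y | Γ₂ y
... | just U | just U' = just (U ⊓ U')
... | just U | nothing = just U
... | nothing | just U' = just U'
... | nothing | nothing = nothing

envω : Term → Env
envω M y = if occurs y M then just ω else nothing

-- Subtyping (reflexivity Φ ⊑ Φ is taken modulo the quotient on types
-- and modulo extensional equality of environments)

data _⊑_ : 𝕌 → 𝕌 → Set where
  ⊑-refl  : ∀ {U V} → U ≈ᵤ V → U ⊑ V
  ⊑-trans : ∀ {U V W} → U ⊑ V → V ⊑ W → U ⊑ W
  ⊑-⊓ˡ    : ∀ {U₁ U₂} → (U₁ ⊓ U₂) ⊑ U₁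
  ⊑-⊓     : ∀ {U₁ U₂ V₁ V₂} → U₁ ⊑ V₁ → U₂ ⊑ V₂ → (U₁ ⊓ U₂) ⊑ (V₁ ⊓ V₂)
  ⊑-⇒     : ∀ {U₁ U₂ T₁ T₂} → U₂ ⊑ U₁ → ty T₁ ⊑ ty T₂ →
            ty (U₁ ⇒ T₁) ⊑ ty (U₂ ⇒ T₂)

data _⊑ₑ_ : Env → Env → Set where
  ⊑ₑ-refl  : ∀ {Γ Δ} → Γ ≗ₑ Δ → Γ ⊑ₑ Δ
  ⊑ₑ-trans : ∀ {Γ Δ Θ} → Γ ⊑ₑ Δ → Δ ⊑ₑ Θ → Γ ⊑ₑ Θ
  ⊑ₑ-ext   : ∀ {Γ x U₁ U₂} → U₁ ⊑ U₂ → Γ x ≡ nothing →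
             (Γ ⸴ x ⦂ U₁) ⊑ₑ (Γ ⸴ x ⦂ U₂)

record Typing : Set where
  constructor ⟨_⊢_⟩
  field
    env : Env
    typ : 𝕌

data _⊑ₜ_ : Typing → Typing → Set where
  ⊑ₜ-refl  : ∀ {Γ Δ U V} → Γ ≗ₑ Δ → U ≈ᵤ V → ⟨ Γ ⊢ U ⟩ ⊑ₜ ⟨ Δ ⊢ V ⟩
  ⊑ₜ-trans : ∀ {Φ Ψ Χ} → Φ ⊑ₜ Ψ → Ψ ⊑ₜ Χ → Φ ⊑ₜ Χ
  ⊑ₜ-rule  : ∀ {Γ₁ Γ₂ U₁ U₂} → U₁ ⊑ U₂ → Γ₂ ⊑ₑ Γ₁ →
             ⟨ Γ₁ ⊢ U₁ ⟩ ⊑ₜ ⟨ Γ₂ ⊢ U₂ ⟩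

data _∶_ : Term → Typing → Set where
  ax   : ∀ x T → fvar x ∶ ⟨ [ x ∶ ty T ] ⊢ ty T ⟩
  ω-ty : ∀ {M} → LC M → M ∶ ⟨ envω M ⊢ ω ⟩
  ⇒i   : ∀ {M Γ x U T} → Γ x ≡ nothing →
         M ∶ ⟨ (Γ ⸴ x ⦂ U) ⊢ ty T ⟩ → ƛ x M ∶ ⟨ Γ ⊢ ty (U ⇒ T) ⟩
  ⇒i'  : ∀ {M Γ x T} → M ∶ ⟨ Γ ⊢ ty T ⟩ → Γ x ≡ nothing →
         ƛ x M ∶ ⟨ Γ ⊢ ty (ω ⇒ T) ⟩
  ⇒e   : ∀ {M₁ M₂ Γ₁ Γ₂ U T} → M₁ ∶ ⟨ Γ₁ ⊢ ty (U ⇒ T) ⟩ → M₂ ∶ ⟨ Γ₂ ⊢ U ⟩ →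
         app M₁ M₂ ∶ ⟨ Γ₁ ⊓ₑ Γ₂ ⊢ ty T ⟩
  ⊓i   : ∀ {M Γ U₁ U₂} → M ∶ ⟨ Γ ⊢ U₁ ⟩ → M ∶ ⟨ Γ ⊢ U₂ ⟩ → M ∶ ⟨ Γ ⊢ U₁ ⊓ U₂ ⟩
  sub  : ∀ {M Φ Ψ} → M ∶ Φ → Φ ⊑ₜ Ψ → M ∶ Ψ

-- Semantics (sets of terms are predicates, only consulted on 𝓜 = LC)

Pred : Set₁
Pred = Term → Set

_↝_ : Pred → Pred → Pred
(X ↝ Y) M = ∀ N → LC N → X N → Y (app M N)

Saturated : RedKind → Pred → Set
Saturated r X = ∀ M N → LC M → M ▷[ r ]* N → X N → X M

record Interpretation (r : RedKind) : Set₁ where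
  field
    𝓘   : Atom → Pred
    sat : ∀ a → Saturated r (𝓘 a)

open Interpretation public

⟦_⟧ₜ : ∀ {r} → 𝕋 → Interpretation r → Pred
⟦_⟧ᵤ : ∀ {r} → 𝕌 → Interpretation r → Pred

⟦ atom a ⟧ₜ I = 𝓘 I a
⟦ U ⇒ T ⟧ₜ I = ⟦ U ⟧ᵤ I ↝ ⟦ T ⟧ₜ I

⟦ ω ⟧ᵤ I M = ⊤
⟦ U ⊓ V ⟧ᵤ I M = ⟦ U ⟧ᵤ I M × ⟦ V ⟧ᵤ I M
⟦ ty T ⟧ᵤ I = ⟦ T ⟧ₜ I

-- The proof builds a term model.  We first set up an auxiliary,
-- syntax-directed typing  E ⊩ M ∶ U  with total contexts E : Var → 𝕌 and a
-- cofinitely quantified abstraction rule, and show it is closed under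
-- subtyping, substitution and inverse substitution, hence under
-- β-expansion (and so under weak head expansion).  Consequently, for any
-- context G, interpreting each atom a by the terms typable at a under G is
-- an r-interpretation 𝓘G.  If every arrow domain V occurring in U is the
-- type G w of some name w, then ⟦U⟧ in 𝓘G is exactly the set of terms
-- typable at U under G (for V ⇒ T, apply the term to w and invert).
-- For the theorem, G gives x_i the type U_i and lists the arrow domains of
-- U, U_1, …, U_n on fresh names; instantiating the hypothesis with N_i = x_i
-- yields G ⊩ M ∶ U, and a final translation turns auxiliary derivations into
-- derivations of the official system with the context restricted to FV(M).

module Submission where

open import Defs
open import Data.Bool using (true; false; if_then_else_; _∨_; T)
open import Data.Bool.Properties using (T-≡)
open import Data.Empty using (⊥; ⊥-elim)
open import Data.Fin using (zero; suc)
import Data.Fin.Properties as Fin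
open import Data.List using (List; []; _∷_; _++_; concatMap)
open import Data.List.Membership.Propositional using () renaming (_∈_ to _∈ₗ_; _∉_ to _∉ₗ_)
open import Data.List.Membership.Propositional.Properties using (∈-++⁺ˡ; ∈-++⁺ʳ; ∈-concat⁺′; ∈-map⁺)
open import Data.List.Relation.Unary.All using (All; []; _∷_; tabulate)
open import Data.List.Relation.Unary.All.Properties using (++⁻ˡ; ++⁻ʳ)
open import Data.List.Relation.Unary.Any using (here; there)
open import Data.Maybe using (Maybe; just; nothing; fromMaybe)
open import Data.Nat using (ℕ; zero; suc; _+_; _∸_; _≤_; _<_; z≤n; s≤s; s≤s⁻¹; _≡ᵇ_)
open import Data.Nat.ListAction using (sum)
open import Data.Nat.Properties using (≤-trans; ≤-refl; m≤m+n; m≤n+m; n≤1+n; <-irrefl; ≤∧≢⇒<; ≡ᵇ⇒≡; ≡⇒≡ᵇ; m+n∸m≡n)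
open import Data.Product using (Σ; _×_; _,_)
open import Data.Sum using (_⊎_; inj₁; inj₂)
open import Data.Unit using (⊤; tt)
open import Data.Vec using (Vec; []; _∷_; lookup; map; toList)
open import Data.Vec.Membership.Propositional using (_∈_)
open import Data.Vec.Membership.Propositional.Properties using (∈-toList⁺)
open import Data.Vec.Properties using (lookup-map)
open import Data.Vec.Relation.Unary.Any using () renaming (here to hereᵥ; there to thereᵥ)
open import Function using (id; _∘_)
open import Function.Bundles using (_⇔_; mk⇔; Equivalence)
open Equivalence using (to; from)
open import Relation.Binary.Construct.Closure.ReflexiveTransitive using (Star; ε; _◅_)
import Relation.Binary.Construct.Closure.ReflexiveTransitive as Star
open import Relation.Binary.PropositionalEquality using (_≡_; _≢_; refl; sym; trans; cong; cong₂)
import Relation.Binary.PropositionalEquality as ≡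
open import Relation.Nullary using (¬_)

≡ᵇ-true⇒≡ : ∀ {x y} → (x ≡ᵇ y) ≡ true → x ≡ y
≡ᵇ-true⇒≡ {x} {y} e = ≡ᵇ⇒≡ x y (Equivalence.from T-≡ e)

true≢false : true ≢ false
true≢false ()

≡ᵇ-refl : ∀ x → (x ≡ᵇ x) ≡ true
≡ᵇ-refl x = Equivalence.to T-≡ (≡⇒≡ᵇ x x refl)

-- A view on name equality that also records the value of the boolean test,
-- so that the conditionals of Defs can be rewritten away.
data NameEq (x y : Var) : Set where
  same : x ≡ y → (x ≡ᵇ y) ≡ true  → NameEq x y
  diff : x ≢ y → (x ≡ᵇ y) ≡ false → NameEq x y

nameEq : ∀ x y → NameEq x y
nameEq x y with x ≡ᵇ y in e
... | true  = same (≡ᵇ-true⇒≡ e) e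
... | false = diff (λ x≡y → ≡.subst T e (≡⇒≡ᵇ x y x≡y)) e

≢⇒≡ᵇ-false : ∀ {x y} → x ≢ y → (x ≡ᵇ y) ≡ false
≢⇒≡ᵇ-false {x} {y} x≢y with nameEq x y
... | same x≡y _ = ⊥-elim (x≢y x≡y)
... | diff _ e   = e

∨-true⁻ : ∀ a b → a ∨ b ≡ true → a ≡ true ⊎ b ≡ true
∨-true⁻ true  b e = inj₁ refl
∨-true⁻ false b e = inj₂ e

∨-false⁻ : ∀ a b → a ∨ b ≡ false → a ≡ false × b ≡ false
∨-false⁻ false b e = refl , e

∨-trueˡ : ∀ {a} b → a ≡ true → a ∨ b ≡ true
∨-trueˡ b refl = refl

∨-trueʳ : ∀ a {b} → b ≡ true → a ∨ b ≡ true
∨-trueʳ true  e = refl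
∨-trueʳ false e = e

fresh : List Var → Var
fresh L = suc (sum L)

∈⇒≤sum : ∀ {y L} → y ∈ₗ L → y ≤ sum L
∈⇒≤sum {L = x ∷ L} (here refl) = m≤m+n x (sum L)
∈⇒≤sum {L = x ∷ L} (there p)   = ≤-trans (∈⇒≤sum p) (m≤n+m (sum L) x)

above-fresh-∉ : ∀ L {y} → fresh L ≤ y → y ∉ₗ L
above-fresh-∉ L le y∈L = <-irrefl refl (≤-trans le (∈⇒≤sum y∈L))

fresh-∉ : ∀ L → fresh L ∉ₗ L
fresh-∉ L = above-fresh-∉ L ≤-refl

∉-++ˡ : ∀ {y : Var} L L' → y ∉ₗ L ++ L' → y ∉ₗ L
∉-++ˡ L L' y∉ p = y∉ (∈-++⁺ˡ {ys = L'} p)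

∉-++ʳ : ∀ {y : Var} L L' → y ∉ₗ L ++ L' → y ∉ₗ L'
∉-++ʳ L L' y∉ p = y∉ (∈-++⁺ʳ L {ys = L'} p)

∈-concatMap : ∀ {g : Var → List Var} {w y L} → w ∈ₗ L → y ∈ₗ g w → y ∈ₗ concatMap g L
∈-concatMap {g} w∈L y∈gw = ∈-concat⁺′ y∈gw (∈-map⁺ g w∈L)

-- Locally nameless syntax

names : Term → List Var
names (bvar i)  = []
names (fvar x)  = x ∷ []
names (app s t) = names s ++ names t
names (lam t)   = names t

occurs⇒∈names : ∀ y t → y ∈FV t → y ∈ₗ names t
occurs⇒∈names y (fvar x)  o = here (≡ᵇ-true⇒≡ o)
occurs⇒∈names y (app s t) o with ∨-true⁻ (occurs y s) (occurs y t) o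
... | inj₁ os = ∈-++⁺ˡ (occurs⇒∈names y s os)
... | inj₂ ot = ∈-++⁺ʳ (names s) (occurs⇒∈names y t ot)
occurs⇒∈names y (lam t)   o = occurs⇒∈names y t o

∉names⇒¬occurs : ∀ y t → y ∉ₗ names t → occurs y t ≡ false
∉names⇒¬occurs y t y∉ with occurs y t in o
... | false = refl
... | true  = ⊥-elim (y∉ (occurs⇒∈names y t o))

infix 30 _^_
_^_ : Term → Var → Term
t ^ z = openAt 0 (fvar z) t

data LCAt : ℕ → Term → Set where
  lcat-bvar : ∀ {k i} → i < k → LCAt k (bvar i)
  lcat-fvar : ∀ {k x} → LCAt k (fvar x)
  lcat-app  : ∀ {k s t} → LCAt k s → LCAt k t → LCAt k (app s t)
  lcat-lam  : ∀ {k t} → LCAt (suc k) t → LCAt k (lam t)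

lcAt-weaken : ∀ {k k' t} → k ≤ k' → LCAt k t → LCAt k' t
lcAt-weaken le (lcat-bvar p)   = lcat-bvar (≤-trans p le)
lcAt-weaken le lcat-fvar       = lcat-fvar
lcAt-weaken le (lcat-app a b)  = lcat-app (lcAt-weaken le a) (lcAt-weaken le b)
lcAt-weaken le (lcat-lam a)    = lcat-lam (lcAt-weaken (s≤s le) a)

lcAt-open : ∀ k u t → LCAt (suc k) t → LCAt k u → LCAt k (openAt k u t)
lcAt-open k u (bvar i) (lcat-bvar p) lu with nameEq i k
... | same refl e rewrite e = lu
... | diff i≢k e rewrite e = lcat-bvar (≤∧≢⇒< (s≤s⁻¹ p) i≢k)
lcAt-open k u (fvar x)  _              lu = lcat-fvar
lcAt-open k u (app s t) (lcat-app a b) lu = lcat-app (lcAt-open k u s a lu) (lcAt-open k u t b lu)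
lcAt-open k u (lam t)   (lcat-lam a)   lu =
  lcat-lam (lcAt-open (suc k) u t a (lcAt-weaken (n≤1+n k) lu))

lcAt-open⁻ : ∀ k x t → LCAt k (openAt k (fvar x) t) → LCAt (suc k) t
lcAt-open⁻ k x (bvar i) a with nameEq i k
... | same refl e = lcat-bvar ≤-refl
... | diff _ e rewrite e with a
...   | lcat-bvar p = lcat-bvar (≤-trans p (n≤1+n k))
lcAt-open⁻ k x (fvar y)  _              = lcat-fvar
lcAt-open⁻ k x (app s t) (lcat-app a b) = lcat-app (lcAt-open⁻ k x s a) (lcAt-open⁻ k x t b)
lcAt-open⁻ k x (lam t)   (lcat-lam a)   = lcat-lam (lcAt-open⁻ (suc k) x t a)

lc⇒lcAt : ∀ {M} → LC M → LCAt 0 M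
lc⇒lcAt (lc-var x)           = lcat-fvar
lc⇒lcAt (lc-app a b)         = lcat-app (lc⇒lcAt a) (lc⇒lcAt b)
lc⇒lcAt {lam t} (lc-lam h)   = lcat-lam (lcAt-open⁻ 0 0 t (lc⇒lcAt (h 0)))

-- … and conversely, by induction on the size of terms (opening preserves it).
size : Term → ℕ
size (bvar i)  = 1
size (fvar x)  = 1
size (app s t) = suc (size s + size t)
size (lam t)   = suc (size t)

size-open : ∀ k x t → size (openAt k (fvar x) t) ≡ size t
size-open k x (bvar i) with i ≡ᵇ k
... | true  = refl
... | false = refl
size-open k x (fvar y)  = refl
size-open k x (app s t) = cong₂ (λ a b → suc (a + b)) (size-open k x s) (size-open k x t)
size-open k x (lam t)   = cong suc (size-open (suc k) x t)

lcAt⇒lc-bounded : ∀ n M → size M ≤ n → LCAt 0 M → LC M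
lcAt⇒lc-bounded n       (bvar i)  _        (lcat-bvar ())
lcAt⇒lc-bounded n       (fvar x)  _        _ = lc-var x
lcAt⇒lc-bounded (suc n) (app s t) (s≤s le) (lcat-app a b) =
  lc-app (lcAt⇒lc-bounded n s (≤-trans (m≤m+n (size s) (size t)) le) a)
         (lcAt⇒lc-bounded n t (≤-trans (m≤n+m (size t) (size s)) le) b)
lcAt⇒lc-bounded (suc n) (lam t)   (s≤s le) (lcat-lam a) =
  lc-lam λ x → lcAt⇒lc-bounded n (t ^ x) (≡.subst (_≤ n) (sym (size-open 0 x t)) le)
                                 (lcAt-open 0 (fvar x) t a lcat-fvar)

lcAt⇒lc : ∀ {M} → LCAt 0 M → LC M
lcAt⇒lc {M} = lcAt⇒lc-bounded (size M) M ≤-refl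

open-lcAt-id : ∀ {j} k u M → LCAt j M → j ≤ k → openAt k u M ≡ M
open-lcAt-id k u (bvar i) (lcat-bvar p) le with nameEq i k
... | same refl _ = ⊥-elim (<-irrefl refl (≤-trans p le))
... | diff _ e rewrite e = refl
open-lcAt-id k u (fvar x)  _              le = refl
open-lcAt-id k u (app s t) (lcat-app a b) le = cong₂ app (open-lcAt-id k u s a le) (open-lcAt-id k u t b le)
open-lcAt-id k u (lam t)   (lcat-lam a)   le = cong lam (open-lcAt-id (suc k) u t a (s≤s le))

open-lc-id : ∀ {M} → LC M → ∀ k u → openAt k u M ≡ M
open-lc-id {M} lc k u = open-lcAt-id k u M (lc⇒lcAt lc) z≤n

close-open : ∀ k z t → occurs z t ≡ false → closeAt k z (openAt k (fvar z) t) ≡ t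
close-open k z (bvar i) o with nameEq i k
... | same refl e rewrite e | ≡ᵇ-refl z = refl
... | diff _ e rewrite e = refl
close-open k z (fvar y) o with nameEq y z
... | same refl e rewrite e with o
...   | ()
close-open k z (fvar y) o | diff _ e rewrite e = refl
close-open k z (app s t) o with ∨-false⁻ (occurs z s) (occurs z t) o
... | os , ot = cong₂ app (close-open k z s os) (close-open k z t ot)
close-open k z (lam t) o = cong lam (close-open (suc k) z t o)

open-close : ∀ k x M → LCAt k M → openAt k (fvar x) (closeAt k x M) ≡ M
open-close k x (bvar i) (lcat-bvar p) rewrite ≢⇒≡ᵇ-false {i} {k} (λ { refl → <-irrefl refl p }) = refl
open-close k x (fvar y) _ with nameEq y x
... | same refl e rewrite e | ≡ᵇ-refl k = refl
... | diff _ e rewrite e = refl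
open-close k x (app s t) (lcat-app a b) = cong₂ app (open-close k x s a) (open-close k x t b)
open-close k x (lam t)   (lcat-lam a)   = cong lam (open-close (suc k) x t a)

lcAt-close : ∀ k x M → LCAt k M → LCAt (suc k) (closeAt k x M)
lcAt-close k x (bvar i) (lcat-bvar p) = lcat-bvar (≤-trans p (n≤1+n k))
lcAt-close k x (fvar y) _ with nameEq y x
... | same _ e rewrite e = lcat-bvar ≤-refl
... | diff _ e rewrite e = lcat-fvar
lcAt-close k x (app s t) (lcat-app a b) = lcat-app (lcAt-close k x s a) (lcAt-close k x t b)
lcAt-close k x (lam t)   (lcat-lam a)   = lcat-lam (lcAt-close (suc k) x t a)

lc-ƛ : ∀ x {M} → LC M → LC (ƛ x M)
lc-ƛ x {M} lc = lcAt⇒lc (lcat-lam (lcAt-close 0 x M (lc⇒lcAt lc)))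

lc-body : ∀ {t} → LC (lam t) → ∀ z → LC (t ^ z)
lc-body (lc-lam h) z = h z

lc-open : ∀ {t u} → LC (lam t) → LC u → LC (openAt 0 u t)
lc-open {t} {u} lt lu with lc⇒lcAt lt
... | lcat-lam a = lcAt⇒lc (lcAt-open 0 u t a (lc⇒lcAt lu))

occurs-open : ∀ {y z} → y ≢ z → ∀ k t → occurs y (openAt k (fvar z) t) ≡ occurs y t
occurs-open {y} {z} y≢z k (bvar i) with i ≡ᵇ k
... | true  = ≢⇒≡ᵇ-false y≢z
... | false = refl
occurs-open y≢z k (fvar x)  = refl
occurs-open y≢z k (app s t) = cong₂ _∨_ (occurs-open y≢z k s) (occurs-open y≢z k t)
occurs-open y≢z k (lam t)   = occurs-open y≢z (suc k) t

occurs-body : ∀ {y z} t → y ≢ z → y ∈FV (t ^ z) → y ∈FV t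
occurs-body t y≢z o = trans (sym (occurs-open y≢z 0 t)) o

¬occurs-close : ∀ k x M → occurs x (closeAt k x M) ≡ false
¬occurs-close k x (bvar i) = refl
¬occurs-close k x (fvar y) with nameEq y x
... | same _ e    rewrite e = refl
... | diff y≢x e  rewrite e = ≢⇒≡ᵇ-false (λ x≡y → y≢x (sym x≡y))
¬occurs-close k x (app s t) rewrite ¬occurs-close k x s | ¬occurs-close k x t = refl
¬occurs-close k x (lam t) = ¬occurs-close (suc k) x t

subst-open : ∀ σ → (∀ w → LC (σ w)) → ∀ k u t →
             subst σ (openAt k u t) ≡ openAt k (subst σ u) (subst σ t)
subst-open σ lσ k u (bvar i) with i ≡ᵇ k
... | true  = refl
... | false = refl
subst-open σ lσ k u (fvar y)  = sym (open-lc-id (lσ y) k (subst σ u))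
subst-open σ lσ k u (app s t) = cong₂ app (subst-open σ lσ k u s) (subst-open σ lσ k u t)
subst-open σ lσ k u (lam t)   = cong lam (subst-open σ lσ (suc k) u t)

subst-cong : ∀ σ σ' t → (∀ w → w ∈FV t → σ w ≡ σ' w) → subst σ t ≡ subst σ' t
subst-cong σ σ' (bvar i)  h = refl
subst-cong σ σ' (fvar y)  h = h y (≡ᵇ-refl y)
subst-cong σ σ' (app s t) h =
  cong₂ app (subst-cong σ σ' s (λ w o → h w (∨-trueˡ _ o)))
            (subst-cong σ σ' t (λ w o → h w (∨-trueʳ (occurs w s) o)))
subst-cong σ σ' (lam t)   h = cong lam (subst-cong σ σ' t h)

subst-fvar : ∀ t → subst fvar t ≡ t
subst-fvar (bvar i)  = refl
subst-fvar (fvar x)  = refl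
subst-fvar (app s t) = cong₂ app (subst-fvar s) (subst-fvar t)
subst-fvar (lam t)   = cong lam (subst-fvar t)

subst-id : ∀ σ t → (∀ w → w ∈FV t → σ w ≡ fvar w) → subst σ t ≡ t
subst-id σ t h = trans (subst-cong σ fvar t h) (subst-fvar t)

lcAt-subst : ∀ σ → (∀ w → LC (σ w)) → ∀ {k} t → LCAt k t → LCAt k (subst σ t)
lcAt-subst σ lσ (bvar i)  a              = a
lcAt-subst σ lσ (fvar y)  _              = lcAt-weaken z≤n (lc⇒lcAt (lσ y))
lcAt-subst σ lσ (app s t) (lcat-app a b) = lcat-app (lcAt-subst σ lσ s a) (lcAt-subst σ lσ t b)
lcAt-subst σ lσ (lam t)   (lcat-lam a)   = lcat-lam (lcAt-subst σ lσ t a)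

lc-subst : ∀ σ → (∀ w → LC (σ w)) → ∀ {t} → LC t → LC (subst σ t)
lc-subst σ lσ {t} lc = lcAt⇒lc (lcAt-subst σ lσ t (lc⇒lcAt lc))

_≔_ : Var → Term → Var → Term
(z ≔ u) w = if w ≡ᵇ z then u else fvar w

≔-same : ∀ z u → (z ≔ u) z ≡ u
≔-same z u rewrite ≡ᵇ-refl z = refl

≔-other : ∀ z u {y} → y ≢ z → (z ≔ u) y ≡ fvar y
≔-other z u y≢z rewrite ≢⇒≡ᵇ-false y≢z = refl

lc-≔ : ∀ z {u} → LC u → ∀ w → LC ((z ≔ u) w)
lc-≔ z lu w with w ≡ᵇ z
... | true  = lu
... | false = lc-var w

open-as-subst : ∀ z {u} t → LC u → occurs z t ≡ false → subst (z ≔ u) (t ^ z) ≡ openAt 0 u t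
open-as-subst z {u} t lu z∉t = begin
  subst (z ≔ u) (t ^ z)                      ≡⟨ subst-open (z ≔ u) (lc-≔ z lu) 0 (fvar z) t ⟩
  openAt 0 ((z ≔ u) z) (subst (z ≔ u) t)     ≡⟨ cong₂ (openAt 0) (≔-same z u) (subst-id (z ≔ u) t untouched) ⟩
  openAt 0 u t                               ∎
  where
  open ≡.≡-Reasoning
  untouched : ∀ w → w ∈FV t → (z ≔ u) w ≡ fvar w
  untouched w o with nameEq w z
  ... | same refl _ = ⊥-elim (true≢false (trans (sym o) z∉t))
  ... | diff w≢z _  = ≔-other z u w≢z

subst-≔-body : ∀ z {u} y t → LC u → y ≢ z → subst (z ≔ u) (t ^ y) ≡ subst (z ≔ u) t ^ y
subst-≔-body z {u} y t lu y≢z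
  rewrite subst-open (z ≔ u) (lc-≔ z lu) 0 (fvar y) t | ≔-other z u y≢z = refl

_except_ : (Var → Term) → Var → Var → Term
(σ except z) w = if w ≡ᵇ z then fvar z else σ w

lc-except : ∀ σ z → (∀ w → LC (σ w)) → ∀ w → LC ((σ except z) w)
lc-except σ z lσ w with w ≡ᵇ z
... | true  = lc-var z
... | false = lσ w

subst-except-body : ∀ σ z t → (∀ w → LC (σ w)) → z ∉ₗ names t →
                    subst (σ except z) (t ^ z) ≡ subst σ t ^ z
subst-except-body σ z t lσ z∉t = begin
  subst (σ except z) (t ^ z)                             ≡⟨ subst-open (σ except z) (lc-except σ z lσ) 0 (fvar z) t ⟩
  openAt 0 ((σ except z) z) (subst (σ except z) t)       ≡⟨ cong₂ (openAt 0) (cong (λ b → if b then fvar z else σ z) (≡ᵇ-refl z))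
                                                                              (subst-cong (σ except z) σ t agree) ⟩
  subst σ t ^ z                                          ∎
  where
  open ≡.≡-Reasoning
  agree : ∀ w → w ∈FV t → (σ except z) w ≡ σ w
  agree w o rewrite ≢⇒≡ᵇ-false {w} {z} (λ { refl → z∉t (occurs⇒∈names w t o) }) = refl

⊑-id : ∀ {U} → U ⊑ U
⊑-id = ⊑-refl ≈ᵤ-refl

⊑-reflexive : ∀ {U V} → U ≡ V → U ⊑ V
⊑-reflexive refl = ⊑-id

⊑-ω : ∀ {U} → U ⊑ ω
⊑-ω = ⊑-trans (⊑-refl (≈ᵤ-sym ω-unit)) ⊑-⊓ˡ

⊑-⊓ʳ : ∀ {U V} → (U ⊓ V) ⊑ V
⊑-⊓ʳ = ⊑-trans (⊑-refl ⊓-comm) ⊑-⊓ˡ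

⊑-glb : ∀ {W U V} → W ⊑ U → W ⊑ V → W ⊑ (U ⊓ V)
⊑-glb p q = ⊑-trans (⊑-refl (≈ᵤ-sym ⊓-idem)) (⊑-⊓ p q)

-- The auxiliary typing system

Ctx : Set
Ctx = Var → 𝕌

_[_↦_] : Ctx → Var → 𝕌 → Ctx
(E [ z ↦ V ]) y = if y ≡ᵇ z then V else E y

↦-same : ∀ E z V → (E [ z ↦ V ]) z ≡ V
↦-same E z V rewrite ≡ᵇ-refl z = refl

↦-other : ∀ E z V {y} → y ≢ z → (E [ z ↦ V ]) y ≡ E y
↦-other E z V y≢z rewrite ≢⇒≡ᵇ-false y≢z = refl

↦-mono : ∀ E z {V V'} → V ⊑ V' → ∀ y → (E [ z ↦ V ]) y ⊑ (E [ z ↦ V' ]) y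
↦-mono E z V⊑V' y with y ≡ᵇ z
... | true  = V⊑V'
... | false = ⊑-id

↦-swap : ∀ E {y z} V W → y ≢ z → ∀ w → ((E [ z ↦ V ]) [ y ↦ W ]) w ≡ ((E [ y ↦ W ]) [ z ↦ V ]) w
↦-swap E {y} {z} V W y≢z w with nameEq w y | nameEq w z
... | same refl _ | same refl _ = ⊥-elim (y≢z refl)
... | same _ ey   | diff _ ez   rewrite ey | ez = refl
... | diff _ ey   | same _ ez   rewrite ey | ez = refl
... | diff _ ey   | diff _ ez   rewrite ey | ez = refl

infix 4 _⊩_∶ₜ_ _⊩_∶ᵤ_

data _⊩_∶ₜ_ : Ctx → Term → 𝕋 → Set
data _⊩_∶ᵤ_ : Ctx → Term → 𝕌 → Set

data _⊩_∶ₜ_ where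
  ⊩var : ∀ {E x T} → E x ⊑ ty T → E ⊩ fvar x ∶ₜ T
  ⊩app : ∀ {E M N W T} → E ⊩ M ∶ₜ W ⇒ T → E ⊩ N ∶ᵤ W → E ⊩ app M N ∶ₜ T
  ⊩lam : ∀ {E t U T} (L : List Var) →
         (∀ z → z ∉ₗ L → E [ z ↦ U ] ⊩ t ^ z ∶ₜ T) → E ⊩ lam t ∶ₜ U ⇒ T
  ⊩sub : ∀ {E M T T'} → E ⊩ M ∶ₜ T → ty T ⊑ ty T' → E ⊩ M ∶ₜ T'

data _⊩_∶ᵤ_ where
  ⊩ω  : ∀ {E M} → LC M → E ⊩ M ∶ᵤ ω
  ⊩⊓  : ∀ {E M U V} → E ⊩ M ∶ᵤ U → E ⊩ M ∶ᵤ V → E ⊩ M ∶ᵤ U ⊓ V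
  ⊩ty : ∀ {E M T} → E ⊩ M ∶ₜ T → E ⊩ M ∶ᵤ ty T

⊩ty⁻ : ∀ {E M T} → E ⊩ M ∶ᵤ ty T → E ⊩ M ∶ₜ T
⊩ty⁻ (⊩ty d) = d

⊩varᵤ : ∀ {E w} V → E w ⊑ V → E ⊩ fvar w ∶ᵤ V
⊩varᵤ ω       _ = ⊩ω (lc-var _)
⊩varᵤ (U ⊓ V) p = ⊩⊓ (⊩varᵤ U (⊑-trans p ⊑-⊓ˡ)) (⊩varᵤ V (⊑-trans p ⊑-⊓ʳ))
⊩varᵤ (ty T)  p = ⊩ty (⊩var p)

⊩var⁻ : ∀ {E w T} → E ⊩ fvar w ∶ₜ T → E w ⊑ ty T
⊩var⁻ (⊩var p)   = p
⊩var⁻ (⊩sub d q) = ⊑-trans (⊩var⁻ d) q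

⊩varᵤ⁻ : ∀ {E w V} → E ⊩ fvar w ∶ᵤ V → E w ⊑ V
⊩varᵤ⁻ (⊩ω _)   = ⊑-ω
⊩varᵤ⁻ (⊩⊓ a b) = ⊑-glb (⊩varᵤ⁻ a) (⊩varᵤ⁻ b)
⊩varᵤ⁻ (⊩ty d)  = ⊩var⁻ d

⊩app⁻ : ∀ {E M N T} → E ⊩ app M N ∶ₜ T → Σ 𝕌 λ W → E ⊩ M ∶ₜ W ⇒ T × E ⊩ N ∶ᵤ W
⊩app⁻ (⊩app d e) = _ , d , e
⊩app⁻ (⊩sub d q) with ⊩app⁻ d
... | W , d' , e = W , ⊩sub d' (⊑-⇒ ⊑-id q) , e

⊩⇒lc  : ∀ {E M T} → E ⊩ M ∶ₜ T → LC M
⊩ᵤ⇒lc : ∀ {E M U} → E ⊩ M ∶ᵤ U → LC M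
⊩⇒lc (⊩var _)   = lc-var _
⊩⇒lc (⊩app d e) = lc-app (⊩⇒lc d) (⊩ᵤ⇒lc e)
⊩⇒lc {M = lam t} (⊩lam L k) =
  lcAt⇒lc (lcat-lam (lcAt-open⁻ 0 (fresh L) t (lc⇒lcAt (⊩⇒lc (k (fresh L) (fresh-∉ L))))))
⊩⇒lc (⊩sub d _) = ⊩⇒lc d
⊩ᵤ⇒lc (⊩ω lc)   = lc
⊩ᵤ⇒lc (⊩⊓ a _)  = ⊩ᵤ⇒lc a
⊩ᵤ⇒lc (⊩ty d)   = ⊩⇒lc d

⊩ᵤ-≈ : ∀ {E M U V} → U ≈ᵤ V → (E ⊩ M ∶ᵤ U) ⇔ (E ⊩ M ∶ᵤ V)
⊩ᵤ-≈ ≈ᵤ-refl         = mk⇔ id id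
⊩ᵤ-≈ (≈ᵤ-sym e)      = mk⇔ (from (⊩ᵤ-≈ e)) (to (⊩ᵤ-≈ e))
⊩ᵤ-≈ (≈ᵤ-trans e e') = mk⇔ (to (⊩ᵤ-≈ e') ∘ to (⊩ᵤ-≈ e)) (from (⊩ᵤ-≈ e) ∘ from (⊩ᵤ-≈ e'))
⊩ᵤ-≈ (≈ᵤ-ty e)       = mk⇔ (λ d → ⊩ty (⊩sub (⊩ty⁻ d) (⊑-refl (≈ᵤ-ty e))))
                           (λ d → ⊩ty (⊩sub (⊩ty⁻ d) (⊑-refl (≈ᵤ-ty (≈ₜ-sym e)))))
⊩ᵤ-≈ (≈ᵤ-⊓ e e')     = mk⇔ (λ { (⊩⊓ a b) → ⊩⊓ (to (⊩ᵤ-≈ e) a) (to (⊩ᵤ-≈ e') b) })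
                           (λ { (⊩⊓ a b) → ⊩⊓ (from (⊩ᵤ-≈ e) a) (from (⊩ᵤ-≈ e') b) })
⊩ᵤ-≈ ⊓-comm          = mk⇔ (λ { (⊩⊓ a b) → ⊩⊓ b a }) (λ { (⊩⊓ a b) → ⊩⊓ b a })
⊩ᵤ-≈ ⊓-assoc         = mk⇔ (λ { (⊩⊓ (⊩⊓ a b) c) → ⊩⊓ a (⊩⊓ b c) })
                           (λ { (⊩⊓ a (⊩⊓ b c)) → ⊩⊓ (⊩⊓ a b) c })
⊩ᵤ-≈ ⊓-idem          = mk⇔ (λ { (⊩⊓ a _) → a }) (λ a → ⊩⊓ a a)
⊩ᵤ-≈ ω-unit          = mk⇔ (λ { (⊩⊓ _ b) → b }) (λ b → ⊩⊓ (⊩ω (⊩ᵤ⇒lc b)) b)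

⊩ᵤ-⊑ : ∀ {E M U V} → E ⊩ M ∶ᵤ U → U ⊑ V → E ⊩ M ∶ᵤ V
⊩ᵤ-⊑ d        (⊑-refl e)    = to (⊩ᵤ-≈ e) d
⊩ᵤ-⊑ d        (⊑-trans p q) = ⊩ᵤ-⊑ (⊩ᵤ-⊑ d p) q
⊩ᵤ-⊑ (⊩⊓ a _) ⊑-⊓ˡ          = a
⊩ᵤ-⊑ (⊩⊓ a b) (⊑-⊓ p q)     = ⊩⊓ (⊩ᵤ-⊑ a p) (⊩ᵤ-⊑ b q)
⊩ᵤ-⊑ (⊩ty d)  (⊑-⇒ p q)     = ⊩ty (⊩sub d (⊑-⇒ p q))

⊩-mono  : ∀ {E N T} E' → E ⊩ N ∶ₜ T → (∀ y → y ∈FV N → E' y ⊑ E y) → E' ⊩ N ∶ₜ T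
⊩ᵤ-mono : ∀ {E N U} E' → E ⊩ N ∶ᵤ U → (∀ y → y ∈FV N → E' y ⊑ E y) → E' ⊩ N ∶ᵤ U
⊩-mono {N = fvar x} E' (⊩var p) h = ⊩var (⊑-trans (h x (≡ᵇ-refl x)) p)
⊩-mono {N = app M N} E' (⊩app d e) h =
  ⊩app (⊩-mono E' d (λ y o → h y (∨-trueˡ _ o))) (⊩ᵤ-mono E' e (λ y o → h y (∨-trueʳ (occurs y M) o)))
⊩-mono {E} {lam t} E' (⊩lam {U = U} L k) h = ⊩lam L λ z z∉ → ⊩-mono (E' [ z ↦ U ]) (k z z∉) (bodies z)
  where
  bodies : ∀ z y → y ∈FV (t ^ z) → (E' [ z ↦ U ]) y ⊑ (E [ z ↦ U ]) y
  bodies z y o with nameEq y z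
  ... | same _ e    rewrite e = ⊑-id
  ... | diff y≢z e  rewrite e = h y (occurs-body t y≢z o)
⊩-mono E' (⊩sub d q) h = ⊩sub (⊩-mono E' d h) q
⊩ᵤ-mono E' (⊩ω lc)  h = ⊩ω lc
⊩ᵤ-mono E' (⊩⊓ a b) h = ⊩⊓ (⊩ᵤ-mono E' a h) (⊩ᵤ-mono E' b h)
⊩ᵤ-mono E' (⊩ty d)  h = ⊩ty (⊩-mono E' d h)

⊩-cong : ∀ {E N T} E' → E ⊩ N ∶ₜ T → (∀ y → y ∈FV N → E' y ≡ E y) → E' ⊩ N ∶ₜ T
⊩-cong E' d h = ⊩-mono E' d (λ y o → ⊑-reflexive (h y o))

⊩ᵤ-cong : ∀ {E N U} E' → E ⊩ N ∶ᵤ U → (∀ y → y ∈FV N → E' y ≡ E y) → E' ⊩ N ∶ᵤ U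
⊩ᵤ-cong E' d h = ⊩ᵤ-mono E' d (λ y o → ⊑-reflexive (h y o))

⊩-subst  : ∀ {E P T} σ E' → (∀ w → LC (σ w)) → E ⊩ P ∶ₜ T →
           (∀ w → w ∈FV P → E' ⊩ σ w ∶ᵤ E w) → E' ⊩ subst σ P ∶ₜ T
⊩ᵤ-subst : ∀ {E P U} σ E' → (∀ w → LC (σ w)) → E ⊩ P ∶ᵤ U →
           (∀ w → w ∈FV P → E' ⊩ σ w ∶ᵤ E w) → E' ⊩ subst σ P ∶ᵤ U
⊩-subst {P = fvar x} σ E' lσ (⊩var p) h = ⊩ty⁻ (⊩ᵤ-⊑ (h x (≡ᵇ-refl x)) p)
⊩-subst {P = app M N} σ E' lσ (⊩app d e) h =
  ⊩app (⊩-subst σ E' lσ d (λ y o → h y (∨-trueˡ _ o)))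
       (⊩ᵤ-subst σ E' lσ e (λ y o → h y (∨-trueʳ (occurs y M) o)))
⊩-subst {E} {lam t} {U ⇒ T} σ E' lσ (⊩lam L k) h =
  ⊩lam L' λ z z∉ →
    ≡.subst (λ X → E' [ z ↦ U ] ⊩ X ∶ₜ T) (subst-except-body σ z t lσ (∉-++ˡ (names t) _ (∉-++ʳ L _ z∉)))
      (⊩-subst (σ except z) (E' [ z ↦ U ]) (lc-except σ z lσ) (k z (∉-++ˡ L _ z∉)) (premises z z∉))
  where
  -- z must avoid L, the names of t, and the names of their images under σ
  L' = L ++ names t ++ concatMap (names ∘ σ) (names t)
  premises : ∀ z → z ∉ₗ L' → ∀ w → w ∈FV (t ^ z) → E' [ z ↦ U ] ⊩ (σ except z) w ∶ᵤ (E [ z ↦ U ]) w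
  premises z z∉ w o with nameEq w z
  ... | same refl e rewrite e = ⊩varᵤ U (⊑-reflexive (↦-same E' w U))
  ... | diff w≢z e rewrite e =
    ⊩ᵤ-cong (E' [ z ↦ U ]) (h w (occurs-body t w≢z o)) λ y oy → ↦-other E' z U λ { refl →
      ∉-++ʳ (names t) _ (∉-++ʳ L _ z∉)
        (∈-concatMap (occurs⇒∈names w t (occurs-body t w≢z o)) (occurs⇒∈names y (σ w) oy)) }
⊩-subst σ E' lσ (⊩sub d q) h = ⊩sub (⊩-subst σ E' lσ d h) q
⊩ᵤ-subst σ E' lσ (⊩ω lc)  h = ⊩ω (lc-subst σ lσ lc)
⊩ᵤ-subst σ E' lσ (⊩⊓ a b) h = ⊩⊓ (⊩ᵤ-subst σ E' lσ a h) (⊩ᵤ-subst σ E' lσ b h)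
⊩ᵤ-subst σ E' lσ (⊩ty d)  h = ⊩ty (⊩-subst σ E' lσ d h)

⊩-rename : ∀ {E W T} t y → occurs y t ≡ false → E [ y ↦ W ] ⊩ t ^ y ∶ₜ T →
           ∀ y' → occurs y' t ≡ false → E [ y' ↦ W ] ⊩ t ^ y' ∶ₜ T
⊩-rename {E} {W} {T} t y y∉t d y' y'∉t =
  ≡.subst (λ X → E [ y' ↦ W ] ⊩ X ∶ₜ T) (open-as-subst y t (lc-var y') y∉t)
    (⊩-subst (y ≔ fvar y') (E [ y' ↦ W ]) (lc-≔ y (lc-var y')) d premises)
  where
  premises : ∀ w → w ∈FV (t ^ y) → E [ y' ↦ W ] ⊩ (y ≔ fvar y') w ∶ᵤ (E [ y ↦ W ]) w
  premises w o with nameEq w y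
  ... | same refl e rewrite e = ⊩varᵤ W (⊑-reflexive (↦-same E y' W))
  ... | diff w≢y e rewrite e = ⊩varᵤ (E w) (⊑-reflexive (↦-other E y' W λ { refl →
                                  true≢false (trans (sym (occurs-body t w≢y o)) y'∉t) }))

⊩lam-fresh : ∀ {E t U T} y → occurs y t ≡ false → E [ y ↦ U ] ⊩ t ^ y ∶ₜ T → E ⊩ lam t ∶ₜ U ⇒ T
⊩lam-fresh {t = t} y y∉t d = ⊩lam (names t) λ z z∉ → ⊩-rename t y y∉t d z (∉names⇒¬occurs z t z∉)

⊩-↦-weaken : ∀ {E z V V' P T} → V' ⊑ V → E [ z ↦ V ] ⊩ P ∶ₜ T → E [ z ↦ V' ] ⊩ P ∶ₜ T
⊩-↦-weaken {E} {z} p d = ⊩-mono (E [ z ↦ _ ]) d (λ y _ → ↦-mono E z p y)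

⊩ᵤ-↦-weaken : ∀ {E z V V' P U} → V' ⊑ V → E [ z ↦ V ] ⊩ P ∶ᵤ U → E [ z ↦ V' ] ⊩ P ∶ᵤ U
⊩ᵤ-↦-weaken {E} {z} p d = ⊩ᵤ-mono (E [ z ↦ _ ]) d (λ y _ → ↦-mono E z p y)

-- Inverse substitution: if P[z := u] is typable, then so is u, at some V,
-- and P under the assumption z : V.  Unsubst E z u J packages that
-- conclusion for the judgement J about P.
Unsubst : Ctx → Var → Term → (Ctx → Set) → Set
Unsubst E z u Typed = Σ 𝕌 λ V → E ⊩ u ∶ᵤ V × Typed (E [ z ↦ V ])

unsubst-var : ∀ {E U} z {u} y → E ⊩ (z ≔ u) y ∶ᵤ U → LC u →
              Unsubst E z u (λ E' → E' ⊩ fvar y ∶ᵤ U)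
unsubst-var {E} {U} z {u} y d lu with nameEq y z
... | same refl _ = U , ≡.subst (λ X → E ⊩ X ∶ᵤ U) (≔-same z u) d , ⊩varᵤ U (⊑-reflexive (↦-same E y U))
... | diff y≢z _  = ω , ⊩ω lu ,
  ⊩ᵤ-cong (E [ z ↦ ω ]) (≡.subst (λ X → E ⊩ X ∶ᵤ U) (≔-other z u y≢z) d)
          (λ w o → ↦-other E z ω λ { refl → y≢z (sym (≡ᵇ-true⇒≡ o)) })

⊩-unsubst  : ∀ {E T} z {u} P → E ⊩ subst (z ≔ u) P ∶ₜ T → LC P → LC u →
             Unsubst E z u (λ E' → E' ⊩ P ∶ₜ T)
⊩ᵤ-unsubst : ∀ {E U} z {u} P → E ⊩ subst (z ≔ u) P ∶ᵤ U → LC P → LC u →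
             Unsubst E z u (λ E' → E' ⊩ P ∶ᵤ U)
⊩-unsubst z (fvar y) d lP lu with unsubst-var z y (⊩ty d) lu
... | V , du , dy = V , du , ⊩ty⁻ dy
⊩-unsubst z P (⊩sub d q) lP lu with ⊩-unsubst z P d lP lu
... | V , du , dP = V , du , ⊩sub dP q
⊩-unsubst z (app P Q) (⊩app d e) (lc-app lP lQ) lu
  with ⊩-unsubst z P d lP lu | ⊩ᵤ-unsubst z Q e lQ lu
... | V₁ , du₁ , dP | V₂ , du₂ , dQ =
  V₁ ⊓ V₂ , ⊩⊓ du₁ du₂ , ⊩app (⊩-↦-weaken ⊑-⊓ˡ dP) (⊩ᵤ-↦-weaken ⊑-⊓ʳ dQ)
⊩-unsubst {E} z {u} (lam t) (⊩lam {U = W} {T = T} L k) (lc-lam lt) lu =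
  rebind (⊩-unsubst z (t ^ y) (≡.subst (λ X → E [ y ↦ W ] ⊩ X ∶ₜ T) (sym (subst-≔-body z y t lu y≢z)) (k y y∉L))
                    (lt y) lu)
  where
  Avoid = L ++ names t ++ names u ++ z ∷ []
  y = fresh Avoid
  y∉L : y ∉ₗ L
  y∉L = ∉-++ˡ L _ (fresh-∉ Avoid)
  y∉t : y ∉ₗ names t
  y∉t = ∉-++ˡ (names t) _ (∉-++ʳ L _ (fresh-∉ Avoid))
  y∉u : y ∉ₗ names u
  y∉u = ∉-++ˡ (names u) _ (∉-++ʳ (names t) _ (∉-++ʳ L _ (fresh-∉ Avoid)))
  y≢z : y ≢ z
  y≢z y≡z = ∉-++ʳ (names u) _ (∉-++ʳ (names t) _ (∉-++ʳ L _ (fresh-∉ Avoid))) (here y≡z)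
  rebind : Unsubst (E [ y ↦ W ]) z u (λ E' → E' ⊩ t ^ y ∶ₜ T) → Unsubst E z u (λ E' → E' ⊩ lam t ∶ₜ W ⇒ T)
  rebind (V , du , dt) =
    V , ⊩ᵤ-cong E du (λ w o → sym (↦-other E y W λ { refl → y∉u (occurs⇒∈names w u o) }))
      , ⊩lam-fresh y (∉names⇒¬occurs y t y∉t) (⊩-cong _ dt (λ w _ → ↦-swap E V W y≢z w))
⊩ᵤ-unsubst z (fvar y) d lP lu = unsubst-var z y d lu
⊩ᵤ-unsubst z P (⊩ω _) lP lu = ω , ⊩ω lu , ⊩ω lP
⊩ᵤ-unsubst z P (⊩⊓ a b) lP lu with ⊩ᵤ-unsubst z P a lP lu | ⊩ᵤ-unsubst z P b lP lu
... | V₁ , du₁ , dP₁ | V₂ , du₂ , dP₂ =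
  V₁ ⊓ V₂ , ⊩⊓ du₁ du₂ , ⊩⊓ (⊩ᵤ-↦-weaken ⊑-⊓ˡ dP₁) (⊩ᵤ-↦-weaken ⊑-⊓ʳ dP₂)
⊩ᵤ-unsubst z P (⊩ty d) lP lu with ⊩-unsubst z P d lP lu
... | V , du , dP = V , du , ⊩ty dP

▷β-lcˡ : ∀ {M N} → M ▷β N → LC M
▷β-lcˡ (β-red lt lu)   = lc-app lt lu
▷β-lcˡ (β-appl s lt)   = lc-app (▷β-lcˡ s) lt
▷β-lcˡ (β-appr ls s)   = lc-app ls (▷β-lcˡ s)
▷β-lcˡ (β-lam x s)     = lc-ƛ x (▷β-lcˡ s)

▷β-lcʳ : ∀ {M N} → M ▷β N → LC N
▷β-lcʳ (β-red lt lu)   = lc-open lt lu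
▷β-lcʳ (β-appl s lt)   = lc-app (▷β-lcʳ s) lt
▷β-lcʳ (β-appr ls s)   = lc-app ls (▷β-lcʳ s)
▷β-lcʳ (β-lam x s)     = lc-ƛ x (▷β-lcʳ s)

ƛ-body : ∀ x {M} → LC M → closeAt 0 x M ^ x ≡ M
ƛ-body x {M} lc = open-close 0 x M (lc⇒lcAt lc)

⊩ƛ : ∀ {E x M W T} → E [ x ↦ W ] ⊩ M ∶ₜ T → E ⊩ ƛ x M ∶ₜ W ⇒ T
⊩ƛ {E} {x} {M} {W} {T} d =
  ⊩lam-fresh x (¬occurs-close 0 x M) (≡.subst (λ X → E [ x ↦ W ] ⊩ X ∶ₜ T) (sym (ƛ-body x (⊩⇒lc d))) d)

⊩lam-body : ∀ {E W T} t x → occurs x t ≡ false → (L : List Var) →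
            (∀ z → z ∉ₗ L → E [ z ↦ W ] ⊩ t ^ z ∶ₜ T) → E [ x ↦ W ] ⊩ t ^ x ∶ₜ T
⊩lam-body t x x∉t L k = ⊩-rename t y (∉names⇒¬occurs y t y∉t) (k y y∉L) x x∉t
  where
  y = fresh (L ++ names t)
  y∉L = ∉-++ˡ L _ (fresh-∉ (L ++ names t))
  y∉t = ∉-++ʳ L _ (fresh-∉ (L ++ names t))

-- The redex case of subject expansion: the argument is typed by inverse
-- substitution of a fresh name z.
⊩-expand-redex : ∀ {E T t u} z → occurs z t ≡ false → LC (lam t) → LC u →
                 E ⊩ openAt 0 u t ∶ₜ T → E ⊩ app (lam t) u ∶ₜ T
⊩-expand-redex {E} {T} {t} {u} z z∉t lt lu d
  with ⊩-unsubst z (t ^ z) (≡.subst (λ X → E ⊩ X ∶ₜ T) (sym (open-as-subst z t lu z∉t)) d) (lc-body lt z) lu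
... | V , du , dt = ⊩app (⊩lam-fresh z z∉t dt) du

-- Subject expansion: typing is closed under β-expansion.  Besides the redex
-- case, a step under ƛ x is handled on the body at the name x itself.
⊩-expand  : ∀ {M N E T} → M ▷β N → E ⊩ N ∶ₜ T → E ⊩ M ∶ₜ T
⊩ᵤ-expand : ∀ {M N E U} → M ▷β N → E ⊩ N ∶ᵤ U → E ⊩ M ∶ᵤ U
⊩-expand (β-red {t} lt lu) d = ⊩-expand-redex (fresh (names t)) (∉names⇒¬occurs _ t (fresh-∉ (names t))) lt lu d
⊩-expand s (⊩sub d q) = ⊩sub (⊩-expand s d) q
⊩-expand (β-appl s _) (⊩app d e) = ⊩app (⊩-expand s d) e
⊩-expand (β-appr _ s) (⊩app d e) = ⊩app d (⊩ᵤ-expand s e)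
⊩-expand {E = E} (β-lam {M} {M'} x s) (⊩lam {U = W} {T = T} L k) =
  ⊩ƛ (⊩-expand s (≡.subst (λ X → E [ x ↦ W ] ⊩ X ∶ₜ T) (ƛ-body x (▷β-lcʳ s))
                          (⊩lam-body (closeAt 0 x M') x (¬occurs-close 0 x M') L k)))
⊩ᵤ-expand s (⊩ω _)   = ⊩ω (▷β-lcˡ s)
⊩ᵤ-expand s (⊩⊓ a b) = ⊩⊓ (⊩ᵤ-expand s a) (⊩ᵤ-expand s b)
⊩ᵤ-expand s (⊩ty d)  = ⊩ty (⊩-expand s d)

⊩-expand* : ∀ {M N E T} → Star _▷β_ M N → E ⊩ N ∶ₜ T → E ⊩ M ∶ₜ T
⊩-expand* ε        d = d
⊩-expand* (s ◅ ss) d = ⊩-expand s (⊩-expand* ss d)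

apps-▷β : ∀ {M N} qs → All LC qs → M ▷β N → apps M qs ▷β apps N qs
apps-▷β []       []          s = s
apps-▷β (q ∷ qs) (lq ∷ lqs)  s = apps-▷β qs lqs (β-appl s lq)

▷f⇒▷β : ∀ {M N} → M ▷f N → M ▷β N
▷f⇒▷β (f-red qs lt lq lqs) = apps-▷β qs lqs (β-red lt lq)

⊩-saturated : ∀ r E a → Saturated r (λ N → E ⊩ N ∶ₜ atom a)
⊩-saturated f E a M N _ ss d = ⊩-expand* (Star.map ▷f⇒▷β ss) d
⊩-saturated β E a M N _ ss d = ⊩-expand* ss d

-- From the auxiliary system to the official one

restrict : Ctx → Term → Env
restrict E M y = if occurs y M then just (E y) else nothing

_≼_ : Maybe 𝕌 → Maybe 𝕌 → Set
nothing ≼ nothing = ⊤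
just U  ≼ just V  = U ⊑ V
_       ≼ _       = ⊥

≼-refl : ∀ m → m ≼ m
≼-refl nothing  = tt
≼-refl (just U) = ⊑-id

_[_≔ₑ_] : Env → Var → Maybe 𝕌 → Env
(Γ [ y ≔ₑ m ]) w = if w ≡ᵇ y then m else Γ w

⊑ₑ-set : ∀ Γ y m → Γ y ≼ m → Γ ⊑ₑ (Γ [ y ≔ₑ m ])
⊑ₑ-set Γ y m le with Γ y in eq
⊑ₑ-set Γ y nothing _ | nothing = ⊑ₑ-refl unchanged
  where
  unchanged : ∀ w → Γ w ≡ (Γ [ y ≔ₑ nothing ]) w
  unchanged w with nameEq w y
  ... | same refl e rewrite e = eq
  ... | diff _ e    rewrite e = refl
⊑ₑ-set Γ y (just V) U⊑V | just U =
  ⊑ₑ-trans (⊑ₑ-refl split) (⊑ₑ-trans (⊑ₑ-ext {Γ = Γ [ y ≔ₑ nothing ]} U⊑V removed) (⊑ₑ-refl join))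
  where
  split : ∀ w → Γ w ≡ ((Γ [ y ≔ₑ nothing ]) ⸴ y ⦂ U) w
  split w with nameEq w y
  ... | same refl e rewrite e = eq
  ... | diff _ e    rewrite e = refl
  removed : (Γ [ y ≔ₑ nothing ]) y ≡ nothing
  removed rewrite ≡ᵇ-refl y = refl
  join : ∀ w → ((Γ [ y ≔ₑ nothing ]) ⸴ y ⦂ V) w ≡ (Γ [ y ≔ₑ just V ]) w
  join w with w ≡ᵇ y
  ... | true  = refl
  ... | false = refl

-- Environments that agree outside a finite list of names and are pointwise
-- related are related by ⊑ₑ (change one entry of the list at a time).
pointwise⇒⊑ₑ : ∀ L {Γ Δ : Env} → (∀ y → Γ y ≼ Δ y) → (∀ y → y ∉ₗ L → Γ y ≡ Δ y) → Γ ⊑ₑ Δ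
pointwise⇒⊑ₑ []      le agree = ⊑ₑ-refl (λ y → agree y (λ ()))
pointwise⇒⊑ₑ (y ∷ L) {Γ} {Δ} le agree =
  ⊑ₑ-trans (⊑ₑ-set Γ y (Δ y) (le y)) (pointwise⇒⊑ₑ L le' agree')
  where
  le' : ∀ w → (Γ [ y ≔ₑ Δ y ]) w ≼ Δ w
  le' w with nameEq w y
  ... | same refl e rewrite e = ≼-refl (Δ w)
  ... | diff _ e    rewrite e = le w
  agree' : ∀ w → w ∉ₗ L → (Γ [ y ≔ₑ Δ y ]) w ≡ Δ w
  agree' w w∉L with nameEq w y
  ... | same refl e rewrite e = refl
  ... | diff w≢y e  rewrite e = agree w λ { (here w≡y) → w≢y w≡y ; (there w∈L) → w∉L w∈L }

restrict-⊑ₑ : ∀ E M {Δ} → (∀ y → restrict E M y ≼ Δ y) → restrict E M ⊑ₑ Δ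
restrict-⊑ₑ E M {Δ} le = pointwise⇒⊑ₑ (names M) le outside
  where
  outside : ∀ y → y ∉ₗ names M → restrict E M y ≡ Δ y
  outside y y∉M with le y
  ... | le-y rewrite ∉names⇒¬occurs y M y∉M with Δ y
  ...   | nothing = refl

restrict-body : ∀ E t {z w} U → w ≢ z → restrict (E [ z ↦ U ]) (t ^ z) w ≡ restrict E (lam t) w
restrict-body E t {z} {w} U w≢z rewrite occurs-open w≢z 0 t | ↦-other E z U w≢z = refl

⸴-other : ∀ Γ z U {w} → w ≢ z → (Γ ⸴ z ⦂ U) w ≡ Γ w
⸴-other Γ z U w≢z rewrite ≢⇒≡ᵇ-false w≢z = refl

typed-lam : ∀ {E t U T} z → occurs z t ≡ false →
            t ^ z ∶ ⟨ restrict (E [ z ↦ U ]) (t ^ z) ⊢ ty T ⟩ → lam t ∶ ⟨ restrict E (lam t) ⊢ ty (U ⇒ T) ⟩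
typed-lam {E} {t} {U} {T} z z∉t d =
  ≡.subst (λ X → X ∶ ⟨ restrict E (lam t) ⊢ ty (U ⇒ T) ⟩) (cong lam (close-open 0 z t z∉t)) named
  where
  z-undeclared : restrict E (lam t) z ≡ nothing
  z-undeclared rewrite z∉t = refl
  named : ƛ z (t ^ z) ∶ ⟨ restrict E (lam t) ⊢ ty (U ⇒ T) ⟩
  named with occurs z (t ^ z) in o
  ... | true  = ⇒i z-undeclared (sub d (⊑ₜ-refl declared ≈ᵤ-refl))
    where
    declared : ∀ w → restrict (E [ z ↦ U ]) (t ^ z) w ≡ (restrict E (lam t) ⸴ z ⦂ U) w
    declared w with nameEq w z
    ... | same refl e rewrite o | e = refl
    ... | diff w≢z _  = trans (restrict-body E t U w≢z) (sym (⸴-other (restrict E (lam t)) z U w≢z))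
  ... | false = sub (⇒i' (sub d (⊑ₜ-refl unused ≈ᵤ-refl)) z-undeclared)
                    (⊑ₜ-rule (⊑-⇒ ⊑-ω ⊑-id) (⊑ₑ-refl λ _ → refl))
    where
    unused : ∀ w → restrict (E [ z ↦ U ]) (t ^ z) w ≡ restrict E (lam t) w
    unused w with nameEq w z
    ... | same refl _ rewrite o | z∉t = refl
    ... | diff w≢z _  = restrict-body E t U w≢z

-- The translation: each auxiliary rule is matched by the official rule,
-- followed by subsumption comparing the restricted contexts.
⊩⇒typed  : ∀ {E M T} → E ⊩ M ∶ₜ T → M ∶ ⟨ restrict E M ⊢ ty T ⟩
⊩ᵤ⇒typed : ∀ {E M U} → E ⊩ M ∶ᵤ U → M ∶ ⟨ restrict E M ⊢ U ⟩
⊩⇒typed (⊩var {E} {x} {T} p) = sub (ax x T) (⊑ₜ-rule ⊑-id (restrict-⊑ₑ E (fvar x) le))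
  where
  le : ∀ y → restrict E (fvar x) y ≼ [ x ∶ ty T ] y
  le y with nameEq y x
  ... | same refl e rewrite e = p
  ... | diff _ e    rewrite e = tt
⊩⇒typed (⊩app {E} {M} {N} d e) = sub (⇒e (⊩⇒typed d) (⊩ᵤ⇒typed e)) (⊑ₜ-rule ⊑-id (restrict-⊑ₑ E (app M N) le))
  where
  le : ∀ y → restrict E (app M N) y ≼ (restrict E M ⊓ₑ restrict E N) y
  le y with occurs y M | occurs y N
  ... | true  | true  = ⊑-glb ⊑-id ⊑-id
  ... | true  | false = ⊑-id
  ... | false | true  = ⊑-id
  ... | false | false = tt
⊩⇒typed (⊩lam {t = t} L k) =
  typed-lam z (∉names⇒¬occurs z t (∉-++ʳ L _ z-fresh)) (⊩⇒typed (k z (∉-++ˡ L _ z-fresh)))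
  where
  z = fresh (L ++ names t)
  z-fresh = fresh-∉ (L ++ names t)
⊩⇒typed (⊩sub d q) = sub (⊩⇒typed d) (⊑ₜ-rule q (⊑ₑ-refl λ _ → refl))
⊩ᵤ⇒typed {E} {M} (⊩ω lc) = sub (ω-ty lc) (⊑ₜ-rule ⊑-id (restrict-⊑ₑ E M le))
  where
  le : ∀ y → restrict E M y ≼ envω M y
  le y with occurs y M
  ... | true  = ⊑-ω
  ... | false = tt
⊩ᵤ⇒typed (⊩⊓ a b) = ⊓i (⊩ᵤ⇒typed a) (⊩ᵤ⇒typed b)
⊩ᵤ⇒typed (⊩ty d)  = ⊩⇒typed d

-- The term model

domainsᵤ : 𝕌 → List 𝕌
domainsₜ : 𝕋 → List 𝕌
domainsᵤ ω       = []
domainsᵤ (U ⊓ V) = domainsᵤ U ++ domainsᵤ V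
domainsᵤ (ty T)  = domainsₜ T
domainsₜ (atom a) = []
domainsₜ (V ⇒ T)  = V ∷ domainsᵤ V ++ domainsₜ T

module TermModel (r : RedKind) (G : Ctx) where

  𝓘G : Interpretation r
  𝓘G = record { 𝓘 = λ a N → G ⊩ N ∶ₜ atom a ; sat = ⊩-saturated r G }

  Represented : 𝕌 → Set
  Represented V = Σ Var λ w → G w ≡ V

  -- For V ⇒ T,
  -- apply the term to a name of type V and invert the application rule.
  ⟦⟧ᵤ⇔⊩ : ∀ U → All Represented (domainsᵤ U) → ∀ N → LC N → ⟦ U ⟧ᵤ 𝓘G N ⇔ (G ⊩ N ∶ᵤ U)
  ⟦⟧ₜ⇔⊩ : ∀ T → All Represented (domainsₜ T) → ∀ N → LC N → ⟦ T ⟧ₜ 𝓘G N ⇔ (G ⊩ N ∶ₜ T)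
  ⟦⟧ᵤ⇔⊩ ω       _   N lc = mk⇔ (λ _ → ⊩ω lc) (λ _ → tt)
  ⟦⟧ᵤ⇔⊩ (U ⊓ V) rep N lc =
    mk⇔ (λ { (a , b) → ⊩⊓ (to (IH-U) a) (to (IH-V) b) })
        (λ { (⊩⊓ a b) → from IH-U a , from IH-V b })
    where
    IH-U = ⟦⟧ᵤ⇔⊩ U (++⁻ˡ (domainsᵤ U) rep) N lc
    IH-V = ⟦⟧ᵤ⇔⊩ V (++⁻ʳ (domainsᵤ U) rep) N lc
  ⟦⟧ᵤ⇔⊩ (ty T)  rep N lc = mk⇔ (⊩ty ∘ to (⟦⟧ₜ⇔⊩ T rep N lc)) (from (⟦⟧ₜ⇔⊩ T rep N lc) ∘ ⊩ty⁻)
  ⟦⟧ₜ⇔⊩ (atom a) _  N lc = mk⇔ id id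
  ⟦⟧ₜ⇔⊩ (V ⇒ T) ((w , Gw≡V) ∷ rep) N lc = mk⇔ sound complete
    where
    IH-V : ∀ P → LC P → ⟦ V ⟧ᵤ 𝓘G P ⇔ (G ⊩ P ∶ᵤ V)
    IH-V = ⟦⟧ᵤ⇔⊩ V (++⁻ˡ (domainsᵤ V) rep)
    IH-T : ∀ P → LC P → ⟦ T ⟧ₜ 𝓘G P ⇔ (G ⊩ P ∶ₜ T)
    IH-T = ⟦⟧ₜ⇔⊩ T (++⁻ʳ (domainsᵤ V) rep)
    sound : ⟦ V ⇒ T ⟧ₜ 𝓘G N → G ⊩ N ∶ₜ V ⇒ T
    sound h with ⊩app⁻ (to (IH-T (app N (fvar w)) (lc-app lc (lc-var w)))
                          (h (fvar w) (lc-var w) (from (IH-V (fvar w) (lc-var w)) (⊩varᵤ V (⊑-reflexive Gw≡V)))))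
    ... | W , dN , dw = ⊩sub dN (⊑-⇒ (≡.subst (_⊑ W) Gw≡V (⊩varᵤ⁻ dw)) ⊑-id)
    complete : G ⊩ N ∶ₜ V ⇒ T → ⟦ V ⇒ T ⟧ₜ 𝓘G N
    complete d P lP hP = from (IH-T (app N P) (lc-app lc lP)) (⊩app d (to (IH-V P lP) hP))

domainsᵥ : ∀ {n} → Vec 𝕌 n → List 𝕌
domainsᵥ []       = []
domainsᵥ (U ∷ Us) = domainsᵤ U ++ domainsᵥ Us

domainsᵥ-lookup : ∀ {n} (Us : Vec 𝕌 n) i {V} → V ∈ₗ domainsᵤ (lookup Us i) → V ∈ₗ domainsᵥ Us
domainsᵥ-lookup (U ∷ Us) zero    p = ∈-++⁺ˡ p
domainsᵥ-lookup (U ∷ Us) (suc i) p = ∈-++⁺ʳ (domainsᵤ U) (domainsᵥ-lookup Us i p)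

nthOr : List 𝕌 → ℕ → 𝕌
nthOr []       k       = ω
nthOr (V ∷ Ds) zero    = V
nthOr (V ∷ Ds) (suc k) = nthOr Ds k

nthOr-∈ : ∀ {V Ds} → V ∈ₗ Ds → Σ ℕ λ k → nthOr Ds k ≡ V
nthOr-∈ (here refl) = zero , refl
nthOr-∈ (there p) with nthOr-∈ p
... | k , e = suc k , e

envOf-lookup : ∀ {n} (xs : Vec Var n) Us → (∀ i j → lookup xs i ≡ lookup xs j → i ≡ j) →
               ∀ i → envOf xs Us (lookup xs i) ≡ just (lookup Us i)
envOf-lookup (x ∷ xs) (U ∷ Us) inj zero rewrite ≡ᵇ-refl x = refl
envOf-lookup (x ∷ xs) (U ∷ Us) inj (suc i)
  rewrite ≢⇒≡ᵇ-false {lookup xs i} {x} (λ xᵢ≡x → Fin.0≢1+n (inj zero (suc i) (sym xᵢ≡x))) =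
  envOf-lookup xs Us (λ a b e → Fin.suc-injective (inj (suc a) (suc b) e)) i

envOf-∈ : ∀ {n} (xs : Vec Var n) Us {y} → y ∈ xs → Σ 𝕌 λ A → envOf xs Us y ≡ just A
envOf-∈ (x ∷ xs) (U ∷ Us) {y} y∈ with nameEq y x | y∈
... | same _ e    | _           rewrite e = U , refl
... | diff y≢x e  | hereᵥ y≡x    = ⊥-elim (y≢x y≡x)
... | diff _ e    | thereᵥ y∈xs  rewrite e = envOf-∈ xs Us y∈xs

envOf-∉ : ∀ {n} (xs : Vec Var n) Us {y} → ¬ y ∈ xs → envOf xs Us y ≡ nothing
envOf-∉ []       []       y∉ = refl
envOf-∉ (x ∷ xs) (U ∷ Us) {y} y∉ rewrite ≢⇒≡ᵇ-false {y} {x} (y∉ ∘ hereᵥ) = envOf-∉ xs Us (y∉ ∘ thereᵥ)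

-- The context giving each x_i the type U_i and enumerating the list Ds on
-- the names from  fresh xs  on.
contextFor : ∀ {n} → Vec Var n → Vec 𝕌 n → List 𝕌 → Ctx
contextFor xs Us Ds y = fromMaybe (nthOr Ds (y ∸ fresh (toList xs))) (envOf xs Us y)

contextFor-lookup : ∀ {n} (xs : Vec Var n) Us Ds → (∀ i j → lookup xs i ≡ lookup xs j → i ≡ j) →
                    ∀ i → contextFor xs Us Ds (lookup xs i) ≡ lookup Us i
contextFor-lookup xs Us Ds inj i rewrite envOf-lookup xs Us inj i = refl

contextFor-represents : ∀ {n} (xs : Vec Var n) Us Ds {V} → V ∈ₗ Ds → Σ Var λ w → contextFor xs Us Ds w ≡ V
contextFor-represents xs Us Ds V∈Ds with nthOr-∈ V∈Ds
... | k , e = w , represents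
  where
  w = fresh (toList xs) + k
  w∉xs : ¬ w ∈ xs
  w∉xs w∈xs = above-fresh-∉ (toList xs) (m≤m+n (fresh (toList xs)) k) (∈-toList⁺ w∈xs)
  represents : contextFor xs Us Ds w ≡ _
  represents rewrite envOf-∉ xs Us w∉xs | m+n∸m≡n (fresh (toList xs)) k = e

restrict-contextFor : ∀ {n} (xs : Vec Var n) Us Ds M → (∀ y → (y ∈FV M) ⇔ (y ∈ xs)) →
                      restrict (contextFor xs Us Ds) M ≗ₑ envOf xs Us
restrict-contextFor xs Us Ds M fv y with occurs y M in o
... | true with envOf-∈ xs Us (to (fv y) o)
...   | A , e rewrite e = refl
restrict-contextFor xs Us Ds M fv y | false =
  sym (envOf-∉ xs Us λ y∈xs → true≢false (trans (sym (from (fv y) y∈xs)) o))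

substOf-fvar : ∀ {n} (xs : Vec Var n) y → substOf xs (map fvar xs) y ≡ fvar y
substOf-fvar []       y = refl
substOf-fvar (x ∷ xs) y with nameEq y x
... | same y≡x e rewrite e = cong fvar (sym y≡x)
... | diff _ e   rewrite e = substOf-fvar xs y

theorem4p10 : (r : RedKind) (n : ℕ) (xs : Vec Var n) (Us : Vec 𝕌 n) (U : 𝕌) (M : Term) →
    (∀ i j → lookup xs i ≡ lookup xs j → i ≡ j) →
    LC M →
    (∀ y → (y ∈FV M) ⇔ (y ∈ xs)) →
    ((I : Interpretation r) (Ns : Vec Term n) →
      (∀ i → LC (lookup Ns i)) →
      (∀ i → ⟦ lookup Us i ⟧ᵤ I (lookup Ns i)) →
      ⟦ U ⟧ᵤ I (subst (substOf xs Ns) M)) →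
    M ∶ ⟨ envOf xs Us ⊢ U ⟩
theorem4p10 r n xs Us U M inj lcM fv sem =
  sub (⊩ᵤ⇒typed G⊩M) (⊑ₜ-refl (restrict-contextFor xs Us Ds M fv) ≈ᵤ-refl)
  where
  -- every arrow domain of U and of the U_i is represented in G
  Ds = domainsᵤ U ++ domainsᵥ Us
  G  = contextFor xs Us Ds
  open TermModel r G
  represented : ∀ {V} → V ∈ₗ Ds → Represented V
  represented = contextFor-represents xs Us Ds
  -- instantiate the hypothesis with N_i = x_i, which lies in ⟦U_i⟧ as G(x_i) = U_i
  xs-lc : ∀ i → LC (lookup (map fvar xs) i)
  xs-lc i rewrite lookup-map i fvar xs = lc-var _
  xs-sem : ∀ i → ⟦ lookup Us i ⟧ᵤ 𝓘G (lookup (map fvar xs) i)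
  xs-sem i rewrite lookup-map i fvar xs =
    from (⟦⟧ᵤ⇔⊩ (lookup Us i) (tabulate (represented ∘ ∈-++⁺ʳ (domainsᵤ U) ∘ domainsᵥ-lookup Us i)) _ (lc-var _))
         (⊩varᵤ (lookup Us i) (⊑-reflexive (contextFor-lookup xs Us Ds inj i)))
  M-sem : ⟦ U ⟧ᵤ 𝓘G M
  M-sem = ≡.subst (⟦ U ⟧ᵤ 𝓘G) (subst-id _ M (λ w _ → substOf-fvar xs w)) (sem 𝓘G (map fvar xs) xs-lc xs-sem)
  G⊩M : G ⊩ M ∶ᵤ U
  G⊩M = to (⟦⟧ᵤ⇔⊩ U (tabulate (represented ∘ ∈-++⁺ˡ)) M lcM) M-sem
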